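{- Let $G$ be a finite graph with edge set $E(G)$, $F$ a field of characteristic $0$, $r_G$ the maximum size of a matching in $G$, and $1 \le \ell \le k \le r_G$. For integers $a, b \ge 0$ define the $\operatorname{Aut}(G)$-equivariant linear map $\Pi_{a,b} : V_a \otimes V_b \to F[x_e]_{e \in E(G)}$ by $x_M \otimes x_{M'} \mapsto \left(\prod_{e \in M} x_e\right)\left(\prod_{e' \in M'} x_{e'}\right)$. Let $\Phi_{\ell,k} : V_{\ell-1} \otimes V_{k+1} \to V_\ell \otimes V_k$ be the linear map defined on basis elements by \[ x_M \otimes x_{M'} \mapsto \frac{1}{p_{M,M'}} \sum_{(N,N') \in \mathbf{N}(M,M')} x_N \otimes x_{N'} .\] Then $\Pi_{\ell,k} \circ \Phi_{\ell,k} = \Pi_{\ell-1,k+1}$, i.e., the triangle formed by these $\operatorname{Aut}(G)$-equivariant maps commutes.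
   Context: A $k$-matching in $G$ is a set of $k$ pairwise vertex-disjoint edges; $\mathbf{M}_k$ is the set of $k$-matchings. $V_k$ is the $F$-vector space with basis $\{x_M : M \in \mathbf{M}_k\}$, with $\operatorname{Aut}(G)$ acting by $\sigma\cdot x_M = x_{\sigma(M)}$, diagonally on tensor products, and on the polynomial ring $F[x_e]_{e\in E(G)}$ by permuting variables, $\sigma \cdot x_e = x_{\sigma(e)}$. For $M \in \mathbf{M}_{\ell-1}$ and $M' \in \mathbf{M}_{k+1}$, let $G(M,M')$ be the subgraph of edges in exactly one of $M, M'$; call edges of $M$ blue and edges of $M'$ pink. Each component of $G(M,M')$ is a path or an even cycle with alternating colors. A pink chain is a path component with an odd number of edges whose two end edges are in $M'$; $p_{M,M'} \ge 2$ is the number of pink chains. For each pink chain $C$, swapping colors on $C$ yields the pair $(N,N')$ with $N = (M\setminus C)\cup(M'\cap C)$ (an $\ell$-matching) and $N' = (M'\setminus C)\cup(M\cap C)$ (a $k$-matching); $\mathbf{N}(M,M')$ is the set of these $p_{M,M'}$ pairs. -}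

module Defs where

open import Level using (Level; _⊔_)
open import Data.Nat as ℕ using (ℕ; zero; suc; _≤_)
open import Data.Bool as Bool using (Bool; true; false; _xor_)
open import Data.Fin as Fin using (Fin; inject₁; fromℕ)
open import Data.Vec using (Vec; []; _∷_; zipWith; map)
import Data.Vec.Properties as VecP
open import Data.List using (List; []; _∷_; _++_; length; foldr)
import Data.List as List
open import Data.List.Membership.Propositional using () renaming (_∈_ to _∈L_)
open import Data.List.Relation.Unary.Unique.Propositional using (Unique)
open import Data.Fin.Subset using (Subset; _∈_; _∩_; _∪_; ∁; ∣_∣)
open import Data.Product using (Σ; ∃; ∃-syntax; _×_; _,_)
open import Data.Sum using (_⊎_)
open import Relation.Binary.PropositionalEquality using (_≡_; _≢_)
open import Relation.Nullary using (¬_; Dec; yes; no)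
open import Function.Definitions using (Injective)
open import Algebra.Bundles using (CommutativeRing)

record Field (c ℓ : Level) : Set (Level.suc (c ⊔ ℓ)) where
  field
    commutativeRing : CommutativeRing c ℓ
  open CommutativeRing commutativeRing public
  field
    _⁻¹     : Carrier → Carrier
    0≉1     : ¬ (0# ≈ 1#)
    ⁻¹-inverse : ∀ x → ¬ (x ≈ 0#) → (x * (x ⁻¹)) ≈ 1#

module _ {c ℓ} (F : Field c ℓ) where
  open Field F
  natCast : ℕ → Carrier
  natCast zero    = 0#
  natCast (suc n) = 1# + natCast n

  CharZero : Set ℓ
  CharZero = ∀ n → natCast n ≈ 0# → n ≡ 0

record Graph : Set where
  field
    n m  : ℕ
    end₁ end₂ : Fin m → Fin n
  Joins : Fin m → Fin n → Fin n → Set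
  Joins e u v = (end₁ e ≡ u × end₂ e ≡ v) ⊎ (end₁ e ≡ v × end₂ e ≡ u)
  field
    loopless : ∀ e → end₁ e ≢ end₂ e
    simple   : ∀ e e' → Joins e' (end₁ e) (end₂ e) → e ≡ e'

module GraphDefs (G : Graph) where
  open Graph G public

  Incident : Fin n → Fin m → Set
  Incident v e = end₁ e ≡ v ⊎ end₂ e ≡ v

  ShareVertex : Fin m → Fin m → Set
  ShareVertex e e' = ∃[ v ] (Incident v e × Incident v e')

  IsMatching : Subset m → Set
  IsMatching S = ∀ e e' → e ∈ S → e' ∈ S → e ≢ e' → ¬ ShareVertex e e'

  IsKMatching : ℕ → Subset m → Set
  IsKMatching k S = IsMatching S × ∣ S ∣ ≡ k

  IsMaxMatchingSize : ℕ → Set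
  IsMaxMatchingSize r = (∃[ S ] IsKMatching r S) × (∀ S → IsMatching S → ∣ S ∣ ≤ r)

  SymDiff : Subset m → Subset m → Subset m
  SymDiff M M' = zipWith _xor_ M M'

  -- C is a pink chain of G(M,M'):
  --  * C is a connected component of G(M,M') (C ⊆ G(M,M'), and C is
  --    closed under adjacency inside G(M,M'); connectivity follows from
  --    C being a path, see below),
  --  * C is a path v₀ e₁ v₁ … e_t v_t with distinct vertices, t = 2j+1 odd,
  --    whose edge set is exactly C,
  --  * both end edges e₁, e_t lie in M' (pink).
  IsPinkChain : Subset m → Subset m → Subset m → Set
  IsPinkChain M M' C =
    (∀ e → e ∈ C → e ∈ SymDiff M M') ×
    (∀ e e' → e ∈ C → e' ∈ SymDiff M M' → ShareVertex e e' → e' ∈ C) ×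
    (∃[ j ] Σ (Fin (suc (suc (2 ℕ.* j))) → Fin n) λ vs →
            Σ (Fin (suc (2 ℕ.* j)) → Fin m) λ es →
              Injective _≡_ _≡_ vs ×
              (∀ i → Joins (es i) (vs (inject₁ i)) (vs (Fin.suc i))) ×
              (∀ e → (e ∈ C → ∃[ i ] es i ≡ e) × (∃[ i ] es i ≡ e → e ∈ C)) ×
              es Fin.zero ∈ M' × es (fromℕ (2 ℕ.* j)) ∈ M')

  swapN swapN' : Subset m → Subset m → Subset m → Subset m
  swapN  M M' C = (M ∩ ∁ C) ∪ (M' ∩ C)
  swapN' M M' C = (M' ∩ ∁ C) ∪ (M ∩ C)

  IsChainEnumeration : ℕ → ℕ → (Subset m → Subset m → List (Subset m)) → Set
  IsChainEnumeration l k chains =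
    ∀ M M' → IsKMatching (l ℕ.∸ 1) M → IsKMatching (suc k) M' →
      Unique (chains M M') ×
      (∀ C → (C ∈L chains M M' → IsPinkChain M M' C) × (IsPinkChain M M' C → C ∈L chains M M'))

allSubsets : (m : ℕ) → List (Subset m)
allSubsets zero    = [] ∷ []
allSubsets (suc m) = List.map (true ∷_) (allSubsets m) ++ List.map (false ∷_) (allSubsets m)

b2n : Bool → ℕ
b2n true  = 1
b2n false = 0

-- Linear algebra over F.
--  * An element of V_a ⊗ V_b is represented by its coordinate function
--    v : Subset m → Subset m → F w.r.t. the basis x_M ⊗ x_M'
--    (M ∈ 𝐌_a, M' ∈ 𝐌_b); v must vanish off 𝐌_a × 𝐌_b (InV a b v).
--  * A polynomial in F[x_e]_{e∈E(G)} is represented by its coefficient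
--    function on exponent vectors Vec ℕ m (equality = pointwise ≈).

module Linear {c ℓ} (F : Field c ℓ) (G : Graph) where
  open Field F
  open GraphDefs G

  Tensor : Set c
  Tensor = Subset m → Subset m → Carrier

  Poly : Set c
  Poly = Vec ℕ m → Carrier

  InV : ℕ → ℕ → Tensor → Set ℓ
  InV a b v = ∀ S S' → ¬ (IsKMatching a S × IsKMatching b S') → v S S' ≈ 0#

  sumL : ∀ {A : Set} → List A → (A → Carrier) → Carrier
  sumL xs f = foldr (λ x acc → f x + acc) 0# xs

  ind : ∀ {P : Set} → Dec P → Carrier
  ind (yes _) = 1#
  ind (no _)  = 0#

  mono : Subset m → Subset m → Vec ℕ m
  mono S S' = zipWith ℕ._+_ (map b2n S) (map b2n S')

  _≟S_ : (S S' : Subset m) → Dec (S ≡ S')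
  _≟S_ = VecP.≡-dec Bool._≟_

  -- Π_{a,b} (the formula does not depend on a, b; only the domain does)
  Π : Tensor → Poly
  Π v α = sumL (allSubsets m) λ S → sumL (allSubsets m) λ S' →
            v S S' * ind (VecP.≡-dec ℕ._≟_ α (mono S S'))

  Φ : (Subset m → Subset m → List (Subset m)) → Tensor → Tensor
  Φ chains v N N' = sumL (allSubsets m) λ M → sumL (allSubsets m) λ M' →
      v M M' * ((natCast F (length (chains M M')) ⁻¹) *
        sumL (chains M M') λ C →
          ind (N ≟S swapN M M' C) * ind (N' ≟S swapN' M M' C))

module Submission where

-- Π(x_N ⊗ x_N') only depends on the multiset N ⊎ N', which swapping colours along a pink
-- chain does not change.  So Π ∘ Φ sends x_M ⊗ x_M' to p_{M,M'}⁻¹ · p_{M,M'} · Π(x_M ⊗ x_M'),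
-- which is Π(x_M ⊗ x_M') as soon as p_{M,M'} ≠ 0 (characteristic 0).
--
-- That p_{M,M'} ≠ 0 is the combinatorial content.  The blue edges B = M ∖ M' and the pink edges
-- P = M' ∖ M are matchings with |B| < |P|, so counting edge–vertex incidences gives a vertex
-- a covered by a pink edge p = au but by no blue edge.  If u is not covered by a blue edge,
-- p alone is a pink chain.  Otherwise let b = uw be the blue edge at u; B - b and P - p still
-- satisfy |B - b| < |P - p|, and by induction on |P| they have a pink chain C.  Either C avoids w,
-- and is then a pink chain of (B, P) too, or w is an end of C, and p b C (reversing C if
-- needed) is one.

open import Defs
open import Level using (Level)
open import Data.Nat using (ℕ; suc; _≤_; _∸_)
open import Data.Nat.Properties using (≤-trans; m∸n≤m)
open import Data.List using (List; [])
open import Data.List.Membership.Propositional using () renaming (_∈_ to _∈L_)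
open import Data.Fin.Subset using (Subset)
open import Data.Product using (_,_; proj₂)
open import Function using (case_of_)
open import Relation.Binary.PropositionalEquality using (_≡_; subst)

module Combinatorics where
  open import Data.Nat using (ℕ; zero; suc; _+_; _*_; _≤_; _<_; _∸_; z≤n; s≤s; s≤s⁻¹)
  open import Data.Nat.Properties
    using ( ≤-refl; ≤-trans; ≤-antisym; ≤-reflexive; n≤1+n; m≤n+m; m≤n⇒m≤1+n; m≤n⇒m<n∨m≡n
          ; <⇒≱; ≮⇒≥; +-mono-≤; +-suc; +-cancelʳ-<; *-suc; *-cancelˡ-≤; suc-injective
          ; m∸n≤m; n∸n≡0; m∸[m∸n]≡n; ∸-cancelˡ-≡; +-∸-assoc; +-*-semiring; module ≤-Reasoning )
  import Data.Nat.Properties as ℕₚ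
  open import Data.Bool using (_xor_)
  open import Data.Fin as Fin using (Fin)
  import Data.Fin.Properties as Finₚ
  open import Data.Fin.Subset using (Subset; _∈_; _∉_; _─_; _-_; _∩_; _∪_; ⁅_⁆; inside; outside; ∣_∣)
  open import Data.Fin.Subset.Properties
    using (_∈?_; p─⊥≡p; ∩-comm; p─q⊆p; x∈p∧x≢y⇒x∈p-y; x∈⁅x⁆; x∈p∪q⁻; x∈p∪q⁺)
  open import Data.Product using (∃; ∃-syntax; _×_; _,_; proj₂)
  open import Data.Sum as Sum using (_⊎_; inj₁; inj₂)
  open import Data.Vec using ([]; _∷_; here; there; zipWith; tabulate)
  open import Function using (_∘_; case_of_)
  open import Relation.Binary.PropositionalEquality
    using (_≡_; _≢_; refl; sym; trans; cong; cong₂; subst; subst₂; module ≡-Reasoning)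
  open import Relation.Nullary using (¬_; ¬?; Dec; yes; no; does; contradiction)
  open import Relation.Nullary.Decidable using (_×-dec_; _⊎-dec_)
  open import Algebra.Properties.Semiring.Sum +-*-semiring
    using (sum-syntax; ∑-comm; ∑-distrib-+; *-distribˡ-sum; sum-cong-≗)

  𝟙 : ∀ {a} {A : Set a} → Dec A → ℕ
  𝟙 d = b2n (does d)

  𝟙-× : ∀ {A B : Set} (a : Dec A) (b : Dec B) → 𝟙 (a ×-dec b) ≡ 𝟙 a * 𝟙 b
  𝟙-× (yes _) (yes _) = refl
  𝟙-× (yes _) (no _)  = refl
  𝟙-× (no _)  _       = refl

  𝟙-⊎ : ∀ {A B : Set} (a : Dec A) (b : Dec B) → ¬ (A × B) → 𝟙 (a ⊎-dec b) ≡ 𝟙 a + 𝟙 b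
  𝟙-⊎ (yes x) (yes y) ¬xy = contradiction (x , y) ¬xy
  𝟙-⊎ (yes _) (no _)  _   = refl
  𝟙-⊎ (no _)  (yes _) _   = refl
  𝟙-⊎ (no _)  (no _)  _   = refl

  ∑𝟙-none : ∀ {n} {P : Fin n → Set} (P? : ∀ i → Dec (P i)) → (∀ i → ¬ P i) →
            ∑[ i < n ] 𝟙 (P? i) ≡ 0
  ∑𝟙-none {zero}  P? ¬P = refl
  ∑𝟙-none {suc n} P? ¬P with P? Fin.zero
  ... | yes p = contradiction p (¬P Fin.zero)
  ... | no _  = ∑𝟙-none (λ i → P? (Fin.suc i)) (λ i → ¬P (Fin.suc i))

  ∑𝟙-pos⇒∃ : ∀ {n} {P : Fin n → Set} (P? : ∀ i → Dec (P i)) → 0 < ∑[ i < n ] 𝟙 (P? i) → ∃ P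
  ∑𝟙-pos⇒∃ {suc n} P? pos with P? Fin.zero
  ... | yes p = Fin.zero , p
  ... | no _ with ∑𝟙-pos⇒∃ (λ i → P? (Fin.suc i)) pos
  ...   | i , p = Fin.suc i , p

  ∃⇒∑𝟙-pos : ∀ {n} {P : Fin n → Set} (P? : ∀ i → Dec (P i)) {i} → P i → 0 < ∑[ i < n ] 𝟙 (P? i)
  ∃⇒∑𝟙-pos P? {Fin.zero} p with P? Fin.zero
  ... | yes _ = s≤s z≤n
  ... | no ¬p = contradiction p ¬p
  ∃⇒∑𝟙-pos P? {Fin.suc i} p =
    ≤-trans (∃⇒∑𝟙-pos (λ i → P? (Fin.suc i)) p) (m≤n+m _ (𝟙 (P? Fin.zero)))

  ∑𝟙≤1 : ∀ {n} {P : Fin n → Set} (P? : ∀ i → Dec (P i)) → (∀ {i j} → P i → P j → i ≡ j) →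
         ∑[ i < n ] 𝟙 (P? i) ≤ 1
  ∑𝟙≤1 {zero}  P? unique = z≤n
  ∑𝟙≤1 {suc n} P? unique with P? Fin.zero
  ... | yes p = ≤-reflexive (cong suc (∑𝟙-none (λ i → P? (Fin.suc i)) (λ i q → Finₚ.0≢1+n (unique p q))))
  ... | no _  = ∑𝟙≤1 (λ i → P? (Fin.suc i)) (λ p q → Finₚ.suc-injective (unique p q))

  ∑𝟙[a≟v]≡1 : ∀ {n} (a : Fin n) → ∑[ v < n ] 𝟙 (a Fin.≟ v) ≡ 1
  ∑𝟙[a≟v]≡1 a = ≤-antisym (∑𝟙≤1 (a Fin.≟_) (λ p q → trans (sym p) q)) (∃⇒∑𝟙-pos (a Fin.≟_) refl)

  ∑-mono-≤ : ∀ {n} {f g : Fin n → ℕ} → (∀ i → f i ≤ g i) → ∑[ i < n ] f i ≤ ∑[ i < n ] g i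
  ∑-mono-≤ {zero}  f≤g = z≤n
  ∑-mono-≤ {suc n} f≤g = +-mono-≤ (f≤g Fin.zero) (∑-mono-≤ (λ i → f≤g (Fin.suc i)))

  ∣p∣≡∑𝟙∈ : ∀ {n} (p : Subset n) → ∣ p ∣ ≡ ∑[ i < n ] 𝟙 (i ∈? p)
  ∣p∣≡∑𝟙∈ []            = refl
  ∣p∣≡∑𝟙∈ (inside  ∷ p) = cong suc (∣p∣≡∑𝟙∈ p)
  ∣p∣≡∑𝟙∈ (outside ∷ p) = ∣p∣≡∑𝟙∈ p

  x∈p─q⇒x∉q : ∀ {n} {p q : Subset n} {x} → x ∈ p ─ q → x ∉ q
  x∈p─q⇒x∉q {p = inside ∷ p} {outside ∷ q} here      ()
  x∈p─q⇒x∉q {p = _ ∷ p}      {inside ∷ q}  (there x∈) (there x∈q) = x∈p─q⇒x∉q x∈ x∈q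
  x∈p─q⇒x∉q {p = _ ∷ p}      {outside ∷ q} (there x∈) (there x∈q) = x∈p─q⇒x∉q x∈ x∈q

  x∈p⇒∣p-x∣+1≡∣p∣ : ∀ {n} {p : Subset n} {x} → x ∈ p → suc ∣ p - x ∣ ≡ ∣ p ∣
  x∈p⇒∣p-x∣+1≡∣p∣ {p = inside ∷ p} here       = cong (λ q → suc ∣ q ∣) (p─⊥≡p p)
  x∈p⇒∣p-x∣+1≡∣p∣ {p = inside  ∷ p} (there x∈p) = cong suc (x∈p⇒∣p-x∣+1≡∣p∣ x∈p)
  x∈p⇒∣p-x∣+1≡∣p∣ {p = outside ∷ p} (there x∈p) = x∈p⇒∣p-x∣+1≡∣p∣ x∈p

  ∣p─q∣+∣p∩q∣≡∣p∣ : ∀ {n} (p q : Subset n) → ∣ p ─ q ∣ + ∣ p ∩ q ∣ ≡ ∣ p ∣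
  ∣p─q∣+∣p∩q∣≡∣p∣ []            []            = refl
  ∣p─q∣+∣p∩q∣≡∣p∣ (inside  ∷ p) (inside  ∷ q) = trans (+-suc _ _) (cong suc (∣p─q∣+∣p∩q∣≡∣p∣ p q))
  ∣p─q∣+∣p∩q∣≡∣p∣ (inside  ∷ p) (outside ∷ q) = cong suc (∣p─q∣+∣p∩q∣≡∣p∣ p q)
  ∣p─q∣+∣p∩q∣≡∣p∣ (outside ∷ p) (inside  ∷ q) = ∣p─q∣+∣p∩q∣≡∣p∣ p q
  ∣p─q∣+∣p∩q∣≡∣p∣ (outside ∷ p) (outside ∷ q) = ∣p─q∣+∣p∩q∣≡∣p∣ p q

  zipWith-xor≡─∪─ : ∀ {n} (p q : Subset n) → zipWith _xor_ p q ≡ (p ─ q) ∪ (q ─ p)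
  zipWith-xor≡─∪─ []            []            = refl
  zipWith-xor≡─∪─ (inside  ∷ p) (inside  ∷ q) = cong (outside ∷_) (zipWith-xor≡─∪─ p q)
  zipWith-xor≡─∪─ (inside  ∷ p) (outside ∷ q) = cong (inside ∷_) (zipWith-xor≡─∪─ p q)
  zipWith-xor≡─∪─ (outside ∷ p) (inside  ∷ q) = cong (inside ∷_) (zipWith-xor≡─∪─ p q)
  zipWith-xor≡─∪─ (outside ∷ p) (outside ∷ q) = cong (outside ∷_) (zipWith-xor≡─∪─ p q)

  module Degrees (G : Graph) where
    open GraphDefs G

    incident? : ∀ v e → Dec (Incident v e)
    incident? v e = (end₁ e Fin.≟ v) ⊎-dec (end₂ e Fin.≟ v)

    Covers : Subset m → Fin n → Set
    Covers S v = ∃[ e ] (e ∈ S × Incident v e)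

    covers? : ∀ S v → Dec (Covers S v)
    covers? S v = Finₚ.any? (λ e → e ∈? S ×-dec incident? v e)

    deg : Subset m → Fin n → ℕ
    deg S v = ∑[ e < m ] 𝟙 (e ∈? S ×-dec incident? v e)

    ∑-incident≡2 : ∀ e → ∑[ v < n ] 𝟙 (incident? v e) ≡ 2
    ∑-incident≡2 e = begin
      ∑[ v < n ] 𝟙 (incident? v e)
        ≡⟨ sum-cong-≗ (λ v → 𝟙-⊎ (end₁ e Fin.≟ v) (end₂ e Fin.≟ v)
                                  (λ (p , q) → loopless e (trans p (sym q)))) ⟩
      ∑[ v < n ] (𝟙 (end₁ e Fin.≟ v) + 𝟙 (end₂ e Fin.≟ v))
        ≡⟨ ∑-distrib-+ (λ v → 𝟙 (end₁ e Fin.≟ v)) (λ v → 𝟙 (end₂ e Fin.≟ v)) ⟩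
      ∑[ v < n ] 𝟙 (end₁ e Fin.≟ v) + ∑[ v < n ] 𝟙 (end₂ e Fin.≟ v)
        ≡⟨ cong₂ _+_ (∑𝟙[a≟v]≡1 (end₁ e)) (∑𝟙[a≟v]≡1 (end₂ e)) ⟩
      2 ∎
      where open ≡-Reasoning

    handshake : ∀ S → ∑[ v < n ] deg S v ≡ 2 * ∣ S ∣
    handshake S = begin
      ∑[ v < n ] ∑[ e < m ] 𝟙 (e ∈? S ×-dec incident? v e)
        ≡⟨ ∑-comm (λ v e → 𝟙 (e ∈? S ×-dec incident? v e)) ⟩
      ∑[ e < m ] ∑[ v < n ] 𝟙 (e ∈? S ×-dec incident? v e)
        ≡⟨ sum-cong-≗ (λ e → sum-cong-≗ (λ v → 𝟙-× (e ∈? S) (incident? v e))) ⟩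
      ∑[ e < m ] ∑[ v < n ] (𝟙 (e ∈? S) * 𝟙 (incident? v e))
        ≡⟨ sum-cong-≗ (λ e → sym (*-distribˡ-sum (𝟙 (e ∈? S)) (λ v → 𝟙 (incident? v e)))) ⟩
      ∑[ e < m ] (𝟙 (e ∈? S) * ∑[ v < n ] 𝟙 (incident? v e))
        ≡⟨ sum-cong-≗ (λ e → trans (cong (𝟙 (e ∈? S) *_) (∑-incident≡2 e))
                                   (ℕₚ.*-comm (𝟙 (e ∈? S)) 2)) ⟩
      ∑[ e < m ] (2 * 𝟙 (e ∈? S))
        ≡⟨ sym (*-distribˡ-sum 2 (λ e → 𝟙 (e ∈? S))) ⟩
      2 * ∑[ e < m ] 𝟙 (e ∈? S)
        ≡⟨ cong (2 *_) (sym (∣p∣≡∑𝟙∈ S)) ⟩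
      2 * ∣ S ∣ ∎
      where open ≡-Reasoning

    matching-unique : ∀ {S} → IsMatching S → ∀ {v e e'} →
                      e ∈ S → e' ∈ S → Incident v e → Incident v e' → e ≡ e'
    matching-unique matchS {v} {e} {e'} e∈S e'∈S v∼e v∼e' with e Fin.≟ e'
    ... | yes e≡e' = e≡e'
    ... | no e≢e'  = contradiction (v , v∼e , v∼e') (matchS e e' e∈S e'∈S e≢e')

    matching⇒deg≤1 : ∀ {S} → IsMatching S → ∀ v → deg S v ≤ 1
    matching⇒deg≤1 {S} matchS v =
      ∑𝟙≤1 (λ e → e ∈? S ×-dec incident? v e)
           (λ (e∈S , v∼e) (e'∈S , v∼e') → matching-unique matchS e∈S e'∈S v∼e v∼e')

    exposed-vertex : ∀ {B P} → IsMatching P → ∣ B ∣ < ∣ P ∣ → ∃[ a ] (Covers P a × ¬ Covers B a)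
    exposed-vertex {B} {P} matchP ∣B∣<∣P∣ with Finₚ.any? (λ a → covers? P a ×-dec ¬? (covers? B a))
    ... | yes found = found
    ... | no none = contradiction ∣P∣≤∣B∣ (<⇒≱ ∣B∣<∣P∣)
      where
      degP≤degB : ∀ v → deg P v ≤ deg B v
      degP≤degB v with covers? B v
      ... | yes v∈B =
        ≤-trans (matching⇒deg≤1 matchP v) (∃⇒∑𝟙-pos (λ e → e ∈? B ×-dec incident? v e) (proj₂ v∈B))
      ... | no  v∉B =
        ≤-trans (≮⇒≥ (λ pos → none (v , ∑𝟙-pos⇒∃ (λ e → e ∈? P ×-dec incident? v e) pos , v∉B))) z≤n
      ∣P∣≤∣B∣ : ∣ P ∣ ≤ ∣ B ∣
      ∣P∣≤∣B∣ = *-cancelˡ-≤ 2 (subst₂ _≤_ (handshake P) (handshake B) (∑-mono-≤ degP≤degB))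

  ∃≤? : ∀ {Q : ℕ → Set} → (∀ i → Dec (Q i)) → ∀ N → Dec (∃[ i ] (i ≤ N × Q i))
  ∃≤? Q? zero with Q? 0
  ... | yes q = yes (0 , z≤n , q)
  ... | no ¬q = no λ { (0 , _ , q) → ¬q q }
  ∃≤? Q? (suc N) with ∃≤? Q? N | Q? (suc N)
  ... | yes (i , i≤N , q) | _     = yes (i , m≤n⇒m≤1+n i≤N , q)
  ... | no _              | yes q = yes (suc N , ≤-refl , q)
  ... | no ¬∃             | no ¬q = no λ where
    (i , i≤1+N , q) → case m≤n⇒m<n∨m≡n i≤1+N of λ where
      (inj₁ i<1+N) → ¬∃ (i , s≤s⁻¹ i<1+N , q)
      (inj₂ refl)  → ¬q q

  subsetOf : ∀ {n} {P : Fin n → Set} → (∀ i → Dec (P i)) → Subset n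
  subsetOf P? = tabulate (λ i → does (P? i))

  ∈subsetOf⁺ : ∀ {n} {P : Fin n → Set} (P? : ∀ i → Dec (P i)) {x} → P x → x ∈ subsetOf P?
  ∈subsetOf⁺ P? {Fin.zero} px with P? Fin.zero
  ... | yes _ = here
  ... | no ¬p = contradiction px ¬p
  ∈subsetOf⁺ P? {Fin.suc x} px = there (∈subsetOf⁺ (P? ∘ Fin.suc) px)

  ∈subsetOf⁻ : ∀ {n} {P : Fin n → Set} (P? : ∀ i → Dec (P i)) {x} → x ∈ subsetOf P? → P x
  ∈subsetOf⁻ P? {Fin.zero} x∈ with P? Fin.zero
  ... | yes p = p
  ∈subsetOf⁻ P? {Fin.suc x} (there x∈) = ∈subsetOf⁻ (P? ∘ Fin.suc) x∈

  module PinkPaths (G : Graph) where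
    open GraphDefs G
    open Degrees G

    joins-sym : ∀ {e x y} → Joins e x y → Joins e y x
    joins-sym (inj₁ (p , q)) = inj₂ (p , q)
    joins-sym (inj₂ (p , q)) = inj₁ (p , q)

    joins-incidentˡ : ∀ {e x y} → Joins e x y → Incident x e
    joins-incidentˡ (inj₁ (p , _)) = inj₁ p
    joins-incidentˡ (inj₂ (_ , q)) = inj₂ q

    joins-incidentʳ : ∀ {e x y} → Joins e x y → Incident y e
    joins-incidentʳ = joins-incidentˡ ∘ joins-sym

    joins-≢ : ∀ {e x y} → Joins e x y → x ≢ y
    joins-≢ {e} (inj₁ (p , q)) x≡y = loopless e (trans p (trans x≡y (sym q)))
    joins-≢ {e} (inj₂ (p , q)) x≡y = loopless e (trans p (trans (sym x≡y) (sym q)))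

    incident-joins : ∀ {e x y z} → Joins e x y → Incident z e → z ≡ x ⊎ z ≡ y
    incident-joins (inj₁ (p , q)) (inj₁ r) = inj₁ (trans (sym r) p)
    incident-joins (inj₁ (p , q)) (inj₂ r) = inj₂ (trans (sym r) q)
    incident-joins (inj₂ (p , q)) (inj₁ r) = inj₂ (trans (sym r) p)
    incident-joins (inj₂ (p , q)) (inj₂ r) = inj₁ (trans (sym r) q)

    joins-back : ∀ {e x y z} → Joins e x y → Joins e y z → x ≡ z
    joins-back {e} (inj₁ (p , q)) (inj₁ (r , s)) = contradiction (trans r (sym q)) (loopless e)
    joins-back     (inj₁ (p , q)) (inj₂ (r , s)) = trans (sym p) r
    joins-back     (inj₂ (p , q)) (inj₁ (r , s)) = trans (sym q) s
    joins-back {e} (inj₂ (p , q)) (inj₂ (r , s)) = contradiction (trans p (sym s)) (loopless e)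

    incident⇒joins : ∀ {v e} → Incident v e → ∃[ u ] Joins e v u
    incident⇒joins {e = e} (inj₁ p) = end₂ e , inj₁ (p , refl)
    incident⇒joins {e = e} (inj₂ q) = end₁ e , inj₂ (refl , q)

    IsMatching-─ : ∀ {S} T → IsMatching S → IsMatching (S ─ T)
    IsMatching-─ {S} T matchS e e' e∈ e'∈ = matchS e e' (p─q⊆p S T e∈) (p─q⊆p S T e'∈)

    -- Vertices and edges are indexed by ℕ and constrained only on the range
    -- 0 … 2j+1 (resp. 0 … 2j), so that reversing and prepending need no Fin casts.
    record PinkPath (B P : Subset m) : Set where
      field
        j            : ℕ
        vs           : ℕ → Fin n
        es           : ℕ → Fin m
        vs-injective : ∀ {x y} → x ≤ suc (2 * j) → y ≤ suc (2 * j) → vs x ≡ vs y → x ≡ y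
        joins        : ∀ {i} → i ≤ 2 * j → Joins (es i) (vs i) (vs (suc i))
        es∈B⊎P       : ∀ {i} → i ≤ 2 * j → es i ∈ B ⊎ es i ∈ P
        closed       : ∀ {i} e → i ≤ 2 * j → e ∈ B ⊎ e ∈ P → ShareVertex (es i) e →
                       ∃[ i' ] (i' ≤ 2 * j × es i' ≡ e)
        first∈P      : es 0 ∈ P
        last∈P       : es (2 * j) ∈ P

    module _ {B P : Subset m} (C : PinkPath B P) where
      open PinkPath C

      vertex-on-path-edge : ∀ {x} → x ≤ suc (2 * j) → ∃[ i ] (i ≤ 2 * j × Incident (vs x) (es i))
      vertex-on-path-edge {x} x≤ with m≤n⇒m<n∨m≡n x≤
      ... | inj₁ x<  = x , s≤s⁻¹ x< , joins-incidentˡ (joins (s≤s⁻¹ x<))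
      ... | inj₂ refl = 2 * j , ≤-refl , joins-incidentʳ (joins ≤-refl)

      uncovered-index-is-end : IsMatching P → ∀ {x} → x ≤ suc (2 * j) → ¬ Covers B (vs x) →
                               x ≡ 0 ⊎ x ≡ suc (2 * j)
      uncovered-index-is-end matchP {zero}  _  _    = inj₁ refl
      uncovered-index-is-end matchP {suc y} x≤ free with m≤n⇒m<n∨m≡n x≤
      ... | inj₂ x≡ = inj₂ x≡
      ... | inj₁ x< = contradiction (vs-injective y≤′ (s≤s 1+y≤) vs-y≡vs-2+y) (λ ())
        where
        1+y≤ : suc y ≤ 2 * j
        1+y≤ = s≤s⁻¹ x<
        y≤ : y ≤ 2 * j
        y≤ = ≤-trans (n≤1+n y) 1+y≤
        y≤′ : y ≤ suc (2 * j)
        y≤′ = ≤-trans y≤ (n≤1+n _)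
        pink : ∀ {i} → i ≤ 2 * j → Incident (vs (suc y)) (es i) → es i ∈ P
        pink i≤ v∼ with es∈B⊎P i≤
        ... | inj₁ e∈B = contradiction (_ , e∈B , v∼) free
        ... | inj₂ e∈P = e∈P
        before : Incident (vs (suc y)) (es y)
        before = joins-incidentʳ (joins y≤)
        after : Incident (vs (suc y)) (es (suc y))
        after = joins-incidentˡ (joins 1+y≤)
        same-edge : es y ≡ es (suc y)
        same-edge = matching-unique matchP (pink y≤ before) (pink 1+y≤ after) before after
        vs-y≡vs-2+y : vs y ≡ vs (suc (suc y))
        vs-y≡vs-2+y = joins-back (joins y≤) (subst (λ e → Joins e _ _) (sym same-edge) (joins 1+y≤))

      uncovered-vertex-is-end : IsMatching P → ∀ {w i} → ¬ Covers B w → i ≤ 2 * j → Incident w (es i) →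
                                w ≡ vs 0 ⊎ w ≡ vs (suc (2 * j))
      uncovered-vertex-is-end matchP {w} {i} free i≤ w∼ =
        Sum.[ at-end (≤-trans i≤ (n≤1+n _)) , at-end (s≤s i≤) ] (incident-joins (joins i≤) w∼)
        where
        at-end : ∀ {x} → x ≤ suc (2 * j) → w ≡ vs x → w ≡ vs 0 ⊎ w ≡ vs (suc (2 * j))
        at-end x≤ w≡ = Sum.map (trans w≡ ∘ cong vs) (trans w≡ ∘ cong vs)
                         (uncovered-index-is-end matchP x≤ (subst (λ v → ¬ Covers B v) w≡ free))

    reverse : ∀ {B P} → PinkPath B P → PinkPath B P
    reverse {B} {P} C = record
      { j            = j
      ; vs           = λ i → vs (suc T ∸ i)
      ; es           = λ i → es (T ∸ i)
      ; vs-injective = λ {x} {y} x≤ y≤ eq → ∸-cancelˡ-≡ x≤ y≤ (vs-injective (m∸n≤m _ x) (m∸n≤m _ y) eq)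
      ; joins        = λ {i} i≤ → subst (λ k → Joins (es (T ∸ i)) (vs k) (vs (T ∸ i)))
                                        (sym (+-∸-assoc 1 i≤)) (joins-sym (joins (m∸n≤m T i)))
      ; es∈B⊎P       = λ {i} _ → es∈B⊎P (m∸n≤m T i)
      ; closed       = λ {i} e _ e∈ shared → reindex (closed e (m∸n≤m T i) e∈ shared)
      ; first∈P      = last∈P
      ; last∈P       = subst (λ k → es k ∈ P) (sym (n∸n≡0 T)) first∈P
      }
      where
      open PinkPath C
      T : ℕ
      T = 2 * j
      reindex : ∀ {e} → ∃[ i ] (i ≤ T × es i ≡ e) → ∃[ i ] (i ≤ T × es (T ∸ i) ≡ e)
      reindex (i , i≤ , eq) = T ∸ i , m∸n≤m T i , trans (cong es (m∸[m∸n]≡n i≤)) eq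

    pinkEdge : ∀ {B P} → IsMatching P → ∀ {p a u} → p ∈ P → Joins p a u →
               ¬ Covers B a → ¬ Covers B u → PinkPath B P
    pinkEdge {B} {P} matchP {p} {a} {u} p∈P p-au a-free u-free = record
      { j            = 0
      ; vs           = ends
      ; es           = λ _ → p
      ; vs-injective = injective
      ; joins        = λ { z≤n → p-au }
      ; es∈B⊎P       = λ _ → inj₂ p∈P
      ; closed       = closed
      ; first∈P      = p∈P
      ; last∈P       = p∈P
      }
      where
      ends : ℕ → Fin n
      ends zero    = a
      ends (suc _) = u
      injective : ∀ {x y} → x ≤ 1 → y ≤ 1 → ends x ≡ ends y → x ≡ y
      injective {zero}     {zero}     _ _ _  = refl
      injective {zero}     {suc zero} _ _ eq = contradiction eq (joins-≢ p-au)
      injective {suc zero} {zero}     _ _ eq = contradiction (sym eq) (joins-≢ p-au)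
      injective {suc zero} {suc zero} _ _ _  = refl
      injective {suc (suc _)} (s≤s ())
      injective {_} {suc (suc _)} _ (s≤s ())
      closed : ∀ {i} e → i ≤ 0 → e ∈ B ⊎ e ∈ P → ShareVertex p e → ∃[ i' ] (i' ≤ 0 × p ≡ e)
      closed e _ (inj₂ e∈P) (x , x∼p , x∼e) = 0 , z≤n , matching-unique matchP p∈P e∈P x∼p x∼e
      closed e _ (inj₁ e∈B) (x , x∼p , x∼e) with incident-joins p-au x∼p
      ... | inj₁ refl = contradiction (e , e∈B , x∼e) a-free
      ... | inj₂ refl = contradiction (e , e∈B , x∼e) u-free

    x∈p-y⇒x≢y : ∀ {S : Subset m} {x e} → e ∈ S - x → e ≢ x
    x∈p-y⇒x≢y e∈ refl = x∈p─q⇒x∉q e∈ (x∈⁅x⁆ _)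

    module Extend {B P : Subset m} (matchB : IsMatching B) (matchP : IsMatching P)
                  {a u w : Fin n} {p b : Fin m} (p∈P : p ∈ P) (b∈B : b ∈ B)
                  (p-au : Joins p a u) (b-uw : Joins b u w) (a-free : ¬ Covers B a) where

      B₁ P₁ : Subset m
      B₁ = B - b
      P₁ = P - p

      shrink : ∀ {e} → e ∈ B₁ ⊎ e ∈ P₁ → e ∈ B ⊎ e ∈ P
      shrink = Sum.map (p─q⊆p B ⁅ b ⁆) (p─q⊆p P ⁅ p ⁆)

      ≢p : ∀ {e} → e ∈ B₁ ⊎ e ∈ P₁ → e ≢ p
      ≢p (inj₂ e∈P₁) = x∈p-y⇒x≢y e∈P₁
      ≢p (inj₁ e∈B₁) refl = a-free (p , p─q⊆p B ⁅ b ⁆ e∈B₁ , joins-incidentˡ p-au)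

      ≢b : ∀ {e} → e ∈ B₁ ⊎ e ∈ P₁ → e ≢ b
      ≢b (inj₁ e∈B₁) = x∈p-y⇒x≢y e∈B₁
      ≢b (inj₂ e∈P₁) refl = a-free (p , subst (_∈ B) b≡p b∈B , joins-incidentˡ p-au)
        where
        b≡p : b ≡ p
        b≡p = matching-unique matchP (p─q⊆p P ⁅ p ⁆ e∈P₁) p∈P (joins-incidentˡ b-uw) (joins-incidentʳ p-au)

      avoids-a : ∀ {e} → e ∈ B₁ ⊎ e ∈ P₁ → ¬ Incident a e
      avoids-a d a∼e with shrink d
      ... | inj₁ e∈B = a-free (_ , e∈B , a∼e)
      ... | inj₂ e∈P = ≢p d (matching-unique matchP e∈P p∈P a∼e (joins-incidentˡ p-au))

      avoids-u : ∀ {e} → e ∈ B₁ ⊎ e ∈ P₁ → ¬ Incident u e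
      avoids-u d u∼e with shrink d
      ... | inj₁ e∈B = ≢b d (matching-unique matchB e∈B b∈B u∼e (joins-incidentˡ b-uw))
      ... | inj₂ e∈P = ≢p d (matching-unique matchP e∈P p∈P u∼e (joins-incidentʳ p-au))

      avoids-p : ∀ {e x} → e ∈ B₁ ⊎ e ∈ P₁ → Incident x e → ¬ Incident x p
      avoids-p d x∼e x∼p with incident-joins p-au x∼p
      ... | inj₁ refl = avoids-a d x∼e
      ... | inj₂ refl = avoids-u d x∼e

      meets-b-at-w : ∀ {e x} → e ∈ B₁ ⊎ e ∈ P₁ → Incident x e → Incident x b → x ≡ w
      meets-b-at-w d x∼e x∼b with incident-joins b-uw x∼b
      ... | inj₁ refl = contradiction x∼e (avoids-u d)
      ... | inj₂ x≡w  = x≡w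

      w-free : ¬ Covers B₁ w
      w-free (e , e∈B₁ , w∼e) =
        x∈p-y⇒x≢y e∈B₁ (matching-unique matchB (p─q⊆p B ⁅ b ⁆ e∈B₁) b∈B w∼e (joins-incidentʳ b-uw))

      classify : ∀ {e} → e ∈ B ⊎ e ∈ P → e ≡ p ⊎ e ≡ b ⊎ (e ∈ B₁ ⊎ e ∈ P₁)
      classify {e} d with e Fin.≟ p | e Fin.≟ b
      ... | yes e≡p | _       = inj₁ e≡p
      ... | no _    | yes e≡b = inj₂ (inj₁ e≡b)
      ... | no e≢p  | no e≢b  =
        inj₂ (inj₂ (Sum.map (λ e∈B → x∈p∧x≢y⇒x∈p-y e∈B e≢b) (λ e∈P → x∈p∧x≢y⇒x∈p-y e∈P e≢p) d))

      lift : (C : PinkPath B₁ P₁) →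
             (∀ {i} → i ≤ 2 * PinkPath.j C → ¬ Incident w (PinkPath.es C i)) → PinkPath B P
      lift C avoids-w = record
        { j = j ; vs = vs ; es = es ; vs-injective = vs-injective ; joins = joins
        ; es∈B⊎P  = shrink ∘ es∈B⊎P
        ; closed  = closed′
        ; first∈P = p─q⊆p P ⁅ p ⁆ first∈P
        ; last∈P  = p─q⊆p P ⁅ p ⁆ last∈P
        }
        where
        open PinkPath C
        closed′ : ∀ {i} e → i ≤ 2 * j → e ∈ B ⊎ e ∈ P → ShareVertex (es i) e →
                  ∃[ i' ] (i' ≤ 2 * j × es i' ≡ e)
        closed′ e i≤ d (x , x∼esᵢ , x∼e) with classify d
        ... | inj₁ refl        = contradiction x∼e (avoids-p (es∈B⊎P i≤) x∼esᵢ)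
        ... | inj₂ (inj₁ refl) =
          contradiction (subst (λ y → Incident y (es _)) (meets-b-at-w (es∈B⊎P i≤) x∼esᵢ x∼e) x∼esᵢ)
                        (avoids-w i≤)
        ... | inj₂ (inj₂ d₁)   = closed e i≤ d₁ (x , x∼esᵢ , x∼e)

      module Prepend (C : PinkPath B₁ P₁) (starts-at-w : PinkPath.vs C 0 ≡ w) where
        open PinkPath C

        2*1+j : 2 * suc j ≡ suc (suc (2 * j))
        2*1+j = *-suc 2 j

        unfold-bound : ∀ {i k} → i ≤ k + 2 * suc j → i ≤ k + (2 + 2 * j)
        unfold-bound {i} {k} = subst (λ t → i ≤ k + t) 2*1+j

        vs′ : ℕ → Fin n
        vs′ zero          = a
        vs′ (suc zero)    = u
        vs′ (suc (suc i)) = vs i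

        es′ : ℕ → Fin m
        es′ zero          = p
        es′ (suc zero)    = b
        es′ (suc (suc i)) = es i

        a∉C : ∀ {y} → y ≤ suc (2 * j) → a ≢ vs y
        a∉C y≤ refl with vertex-on-path-edge C y≤
        ... | i , i≤ , a∼ = avoids-a (es∈B⊎P i≤) a∼

        u∉C : ∀ {y} → y ≤ suc (2 * j) → u ≢ vs y
        u∉C y≤ refl with vertex-on-path-edge C y≤
        ... | i , i≤ , u∼ = avoids-u (es∈B⊎P i≤) u∼

        vs′-injective : ∀ {x y} → x ≤ 2 + suc (2 * j) → y ≤ 2 + suc (2 * j) → vs′ x ≡ vs′ y → x ≡ y
        vs′-injective {zero}        {zero}        _ _ _ = refl
        vs′-injective {zero}        {suc zero}    _ _ eq = contradiction eq (joins-≢ p-au)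
        vs′-injective {zero}        {suc (suc y)} _ (s≤s (s≤s y≤)) eq = contradiction eq (a∉C y≤)
        vs′-injective {suc zero}    {zero}        _ _ eq = contradiction (sym eq) (joins-≢ p-au)
        vs′-injective {suc zero}    {suc zero}    _ _ _ = refl
        vs′-injective {suc zero}    {suc (suc y)} _ (s≤s (s≤s y≤)) eq = contradiction eq (u∉C y≤)
        vs′-injective {suc (suc x)} {zero}        (s≤s (s≤s x≤)) _ eq = contradiction (sym eq) (a∉C x≤)
        vs′-injective {suc (suc x)} {suc zero}    (s≤s (s≤s x≤)) _ eq = contradiction (sym eq) (u∉C x≤)
        vs′-injective {suc (suc x)} {suc (suc y)} (s≤s (s≤s x≤)) (s≤s (s≤s y≤)) eq =
          cong (suc ∘ suc) (vs-injective x≤ y≤ eq)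

        joins′ : ∀ {i} → i ≤ 2 + 2 * j → Joins (es′ i) (vs′ i) (vs′ (suc i))
        joins′ {zero}        _                = p-au
        joins′ {suc zero}    _                = subst (Joins b u) (sym starts-at-w) b-uw
        joins′ {suc (suc i)} (s≤s (s≤s i≤)) = joins i≤

        es′∈B⊎P : ∀ {i} → i ≤ 2 + 2 * j → es′ i ∈ B ⊎ es′ i ∈ P
        es′∈B⊎P {zero}        _                = inj₂ p∈P
        es′∈B⊎P {suc zero}    _                = inj₁ b∈B
        es′∈B⊎P {suc (suc i)} (s≤s (s≤s i≤)) = shrink (es∈B⊎P i≤)

        shift : ∀ {e} → ∃[ i ] (i ≤ 2 * j × es i ≡ e) → ∃[ i ] (i ≤ 2 * suc j × es′ i ≡ e)
        shift (i , i≤ , eq) = 2 + i , subst (2 + i ≤_) (sym 2*1+j) (s≤s (s≤s i≤)) , eq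

        closed′ : ∀ {i} e → i ≤ 2 + 2 * j → e ∈ B ⊎ e ∈ P → ShareVertex (es′ i) e →
                  ∃[ i' ] (i' ≤ 2 * suc j × es′ i' ≡ e)
        closed′ e i≤ d shared with classify d
        ... | inj₁ refl        = 0 , z≤n , refl
        ... | inj₂ (inj₁ refl) = 1 , subst (1 ≤_) (sym 2*1+j) (s≤s z≤n) , refl
        ... | inj₂ (inj₂ d₁)   = remaining i≤ shared
          where
          remaining : ∀ {i} → i ≤ 2 + 2 * j → ShareVertex (es′ i) e →
                      ∃[ i' ] (i' ≤ 2 * suc j × es′ i' ≡ e)
          remaining {zero}     _ (x , x∼p , x∼e) = contradiction x∼p (avoids-p d₁ x∼e)
          remaining {suc zero} _ (x , x∼b , x∼e) =
            shift (closed e z≤n d₁ (x , subst (λ y → Incident y (es 0)) (trans starts-at-w (sym x≡w))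
                                                (joins-incidentˡ (joins z≤n)) , x∼e))
            where
            x≡w : x ≡ w
            x≡w = meets-b-at-w d₁ x∼e x∼b
          remaining {suc (suc i)} (s≤s (s≤s i≤)) shared′ = shift (closed e i≤ d₁ shared′)

        prepend : PinkPath B P
        prepend = record
          { j            = suc j
          ; vs           = vs′
          ; es           = es′
          ; vs-injective = λ x≤ y≤ → vs′-injective (unfold-bound {k = 1} x≤) (unfold-bound {k = 1} y≤)
          ; joins        = joins′ ∘ unfold-bound {k = 0}
          ; es∈B⊎P       = es′∈B⊎P ∘ unfold-bound {k = 0}
          ; closed       = λ e i≤ → closed′ e (unfold-bound {k = 0} i≤)
          ; first∈P      = p∈P
          ; last∈P       = subst (λ k → es′ k ∈ P) (sym 2*1+j) (p─q⊆p P ⁅ p ⁆ last∈P)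
          }

      extend : PinkPath B₁ P₁ → PinkPath B P
      extend C with ∃≤? (λ i → incident? w (PinkPath.es C i)) (2 * PinkPath.j C)
      ... | no ¬touch = lift C (λ i≤ w∼ → ¬touch (_ , i≤ , w∼))
      ... | yes (i , i≤ , w∼) with uncovered-vertex-is-end C (IsMatching-─ ⁅ p ⁆ matchP) w-free i≤ w∼
      ...   | inj₁ w≡start = Prepend.prepend C (sym w≡start)
      ...   | inj₂ w≡end   = Prepend.prepend (reverse C) (sym w≡end)

    pinkPath : ∀ s {B P} → IsMatching B → IsMatching P → ∣ P ∣ ≡ s → ∣ B ∣ < s → PinkPath B P
    pinkPath zero    _ _ _ ()
    pinkPath (suc s) {B} {P} matchB matchP ∣P∣≡ ∣B∣<
      with exposed-vertex matchP (subst (∣ B ∣ <_) (sym ∣P∣≡) ∣B∣<)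
    ... | a , (p , p∈P , a∼p) , a-free with incident⇒joins a∼p
    ... | u , p-au with covers? B u
    ... | no u-free = pinkEdge matchP p∈P p-au a-free u-free
    ... | yes (b , b∈B , u∼b) with incident⇒joins u∼b
    ... | w , b-uw =
      extend (pinkPath s (IsMatching-─ ⁅ b ⁆ matchB) (IsMatching-─ ⁅ p ⁆ matchP) ∣P₁∣≡ ∣B₁∣<)
      where
      open Extend matchB matchP p∈P b∈B p-au b-uw a-free
      ∣P₁∣≡ : ∣ P₁ ∣ ≡ s
      ∣P₁∣≡ = suc-injective (trans (x∈p⇒∣p-x∣+1≡∣p∣ p∈P) ∣P∣≡)
      ∣B₁∣< : ∣ B₁ ∣ < s
      ∣B₁∣< = s≤s⁻¹ (subst (_< suc s) (sym (x∈p⇒∣p-x∣+1≡∣p∣ b∈B)) ∣B∣<)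

    ∈SymDiff⁻ : ∀ {M M' e} → e ∈ SymDiff M M' → e ∈ M ─ M' ⊎ e ∈ M' ─ M
    ∈SymDiff⁻ {M} {M'} e∈ = x∈p∪q⁻ (M ─ M') (M' ─ M) (subst (_ ∈_) (zipWith-xor≡─∪─ M M') e∈)

    ∈SymDiff⁺ : ∀ {M M' e} → e ∈ M ─ M' ⊎ e ∈ M' ─ M → e ∈ SymDiff M M'
    ∈SymDiff⁺ {M} {M'} d = subst (_ ∈_) (sym (zipWith-xor≡─∪─ M M')) (x∈p∪q⁺ d)

    module _ {M M' : Subset m} (C : PinkPath (M ─ M') (M' ─ M)) where
      open PinkPath C

      OnPath : Fin m → Set
      OnPath e = ∃[ i ] (i ≤ 2 * j × es i ≡ e)

      edgeSet : Subset m
      edgeSet = subsetOf (λ e → ∃≤? (λ i → es i Fin.≟ e) (2 * j))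

      ∈edgeSet⁻ : ∀ {e} → e ∈ edgeSet → OnPath e
      ∈edgeSet⁻ = ∈subsetOf⁻ (λ e → ∃≤? (λ i → es i Fin.≟ e) (2 * j))

      ∈edgeSet⁺ : ∀ {e} → OnPath e → e ∈ edgeSet
      ∈edgeSet⁺ = ∈subsetOf⁺ (λ e → ∃≤? (λ i → es i Fin.≟ e) (2 * j))

      toIsPinkChain : IsPinkChain M M' edgeSet
      toIsPinkChain = inSymDiff , componentClosed , j , vsᶠ , esᶠ , vsᶠ-injective , joinsᶠ , edgesᶠ ,
                      p─q⊆p M' M first∈P ,
                      p─q⊆p M' M (subst (λ i → es i ∈ M' ─ M) (sym (Finₚ.toℕ-fromℕ (2 * j))) last∈P)
        where
        inSymDiff : ∀ e → e ∈ edgeSet → e ∈ SymDiff M M'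
        inSymDiff e e∈ with ∈edgeSet⁻ e∈
        ... | i , i≤ , refl = ∈SymDiff⁺ (es∈B⊎P i≤)
        componentClosed : ∀ e e' → e ∈ edgeSet → e' ∈ SymDiff M M' → ShareVertex e e' → e' ∈ edgeSet
        componentClosed e e' e∈ e'∈ shared with ∈edgeSet⁻ e∈
        ... | i , i≤ , refl = ∈edgeSet⁺ (closed e' i≤ (∈SymDiff⁻ e'∈) shared)
        vsᶠ : Fin (suc (suc (2 * j))) → Fin n
        vsᶠ i = vs (Fin.toℕ i)
        esᶠ : Fin (suc (2 * j)) → Fin m
        esᶠ i = es (Fin.toℕ i)
        vsᶠ-injective : ∀ {x y} → vsᶠ x ≡ vsᶠ y → x ≡ y
        vsᶠ-injective {x} {y} eq =
          Finₚ.toℕ-injective (vs-injective (Finₚ.toℕ≤pred[n] x) (Finₚ.toℕ≤pred[n] y) eq)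
        joinsᶠ : ∀ i → Joins (esᶠ i) (vsᶠ (Fin.inject₁ i)) (vsᶠ (Fin.suc i))
        joinsᶠ i = subst (λ k → Joins (esᶠ i) (vs k) (vs (suc (Fin.toℕ i)))) (sym (Finₚ.toℕ-inject₁ i))
                     (joins (Finₚ.toℕ≤pred[n] i))
        edgesᶠ : ∀ e → (e ∈ edgeSet → ∃[ i ] esᶠ i ≡ e) × (∃[ i ] esᶠ i ≡ e → e ∈ edgeSet)
        edgesᶠ e = (λ e∈ → let (i , i≤ , eq) = ∈edgeSet⁻ e∈ in
                              Fin.fromℕ< (s≤s i≤) , trans (cong es (Finₚ.toℕ-fromℕ< (s≤s i≤))) eq)
                 , (λ (i , eq) → ∈edgeSet⁺ (Fin.toℕ i , Finₚ.toℕ≤pred[n] i , eq))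

    ∣─∣<∣─∣ : ∀ {M M' : Subset m} → ∣ M ∣ < ∣ M' ∣ → ∣ M ─ M' ∣ < ∣ M' ─ M ∣
    ∣─∣<∣─∣ {M} {M'} ∣M∣<∣M'∣ = +-cancelʳ-< (∣ M ∩ M' ∣) _ _ (begin-strict
      ∣ M ─ M' ∣ + ∣ M ∩ M' ∣   ≡⟨ ∣p─q∣+∣p∩q∣≡∣p∣ M M' ⟩
      ∣ M ∣                     <⟨ ∣M∣<∣M'∣ ⟩
      ∣ M' ∣                    ≡⟨ ∣p─q∣+∣p∩q∣≡∣p∣ M' M ⟨
      ∣ M' ─ M ∣ + ∣ M' ∩ M ∣   ≡⟨ cong (λ S → ∣ M' ─ M ∣ + ∣ S ∣) (∩-comm M' M) ⟩
      ∣ M' ─ M ∣ + ∣ M ∩ M' ∣   ∎)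
      where open ≤-Reasoning

    pinkChain-exists : ∀ {a b M M'} → IsKMatching a M → IsKMatching (suc b) M' → a ≤ b →
                       ∃ (IsPinkChain M M')
    pinkChain-exists {M = M} {M'} (matchM , ∣M∣≡a) (matchM' , ∣M'∣≡1+b) a≤b =
      edgeSet C , toIsPinkChain C
      where
      C : PinkPath (M ─ M') (M' ─ M)
      C = pinkPath _ (IsMatching-─ M' matchM) (IsMatching-─ M matchM') refl
                     (∣─∣<∣─∣ {M} {M'} (subst₂ _<_ (sym ∣M∣≡a) (sym ∣M'∣≡1+b) (s≤s a≤b)))

module Polynomials where
  open import Data.Nat as ℕ using (ℕ; zero; suc)
  open import Data.Bool as Bool using (Bool; true; false; _∧_; _∨_; not)
  open import Data.Vec using (Vec; []; _∷_; zipWith; map)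
  import Data.Vec.Properties as Vecₚ
  open import Data.List as List using (List; []; _∷_; _++_; length)
  open import Data.Fin.Subset using (Subset; _∩_; _∪_; ∁)
  open import Function using (case_of_)
  open import Relation.Binary.PropositionalEquality using (_≡_; refl; cong; cong₂)
  open import Relation.Nullary using (Dec; yes; no)

  mono-swap : ∀ {k} (x y c : Subset k) →
    zipWith ℕ._+_ (map b2n ((x ∩ ∁ c) ∪ (y ∩ c))) (map b2n ((y ∩ ∁ c) ∪ (x ∩ c)))
    ≡ zipWith ℕ._+_ (map b2n x) (map b2n y)
  mono-swap []       []       []       = refl
  mono-swap (x ∷ xs) (y ∷ ys) (c ∷ cs) = cong₂ _∷_ (pointwise x y c) (mono-swap xs ys cs)
    where
    pointwise : ∀ x y c → b2n ((x ∧ not c) ∨ (y ∧ c)) ℕ.+ b2n ((y ∧ not c) ∨ (x ∧ c)) ≡ b2n x ℕ.+ b2n y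
    pointwise true  true  true  = refl
    pointwise true  true  false = refl
    pointwise true  false true  = refl
    pointwise true  false false = refl
    pointwise false true  true  = refl
    pointwise false true  false = refl
    pointwise false false true  = refl
    pointwise false false false = refl

  module ListSums {c ℓ} (F : Field c ℓ) (G : Graph) where
    open Field F renaming (refl to ≈-refl; sym to ≈-sym; trans to ≈-trans)
    open Linear F G
    open import Algebra.Properties.CommutativeSemigroup +-commutativeSemigroup using (interchange)
    open import Relation.Binary.Reasoning.Setoid setoid

    sumL-cong : ∀ {A : Set} (xs : List A) {f g : A → Carrier} → (∀ x → f x ≈ g x) → sumL xs f ≈ sumL xs g
    sumL-cong []       f≈g = ≈-refl
    sumL-cong (x ∷ xs) f≈g = +-cong (f≈g x) (sumL-cong xs f≈g)

    sumL-zero : ∀ {A : Set} (xs : List A) {f : A → Carrier} → (∀ x → f x ≈ 0#) → sumL xs f ≈ 0#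
    sumL-zero []       f≈0 = ≈-refl
    sumL-zero (x ∷ xs) f≈0 = ≈-trans (+-cong (f≈0 x) (sumL-zero xs f≈0)) (+-identityˡ 0#)

    *-distribˡ-sumL : ∀ {A : Set} k (xs : List A) (f : A → Carrier) → k * sumL xs f ≈ sumL xs (λ x → k * f x)
    *-distribˡ-sumL k []       f = zeroʳ k
    *-distribˡ-sumL k (x ∷ xs) f = ≈-trans (distribˡ k (f x) (sumL xs f)) (+-cong ≈-refl (*-distribˡ-sumL k xs f))

    *-distribʳ-sumL : ∀ {A : Set} k (xs : List A) (f : A → Carrier) → sumL xs f * k ≈ sumL xs (λ x → f x * k)
    *-distribʳ-sumL k []       f = zeroˡ k
    *-distribʳ-sumL k (x ∷ xs) f = ≈-trans (distribʳ k (f x) (sumL xs f)) (+-cong ≈-refl (*-distribʳ-sumL k xs f))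

    sumL-distrib-+ : ∀ {A : Set} (xs : List A) (f g : A → Carrier) →
                     sumL xs (λ x → f x + g x) ≈ sumL xs f + sumL xs g
    sumL-distrib-+ []       f g = ≈-sym (+-identityˡ 0#)
    sumL-distrib-+ (x ∷ xs) f g =
      ≈-trans (+-cong ≈-refl (sumL-distrib-+ xs f g)) (interchange (f x) (g x) (sumL xs f) (sumL xs g))

    sumL-comm : ∀ {A B : Set} (xs : List A) (ys : List B) (f : A → B → Carrier) →
                sumL xs (λ x → sumL ys (f x)) ≈ sumL ys (λ y → sumL xs (λ x → f x y))
    sumL-comm []       ys f = ≈-sym (sumL-zero ys (λ _ → ≈-refl))
    sumL-comm (x ∷ xs) ys f =
      ≈-trans (+-cong ≈-refl (sumL-comm xs ys f)) (≈-sym (sumL-distrib-+ ys (f x) (λ y → sumL xs (λ x → f x y))))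

    sumL-++ : ∀ {A : Set} (xs ys : List A) (f : A → Carrier) → sumL (xs ++ ys) f ≈ sumL xs f + sumL ys f
    sumL-++ []       ys f = ≈-sym (+-identityˡ _)
    sumL-++ (x ∷ xs) ys f = ≈-trans (+-cong ≈-refl (sumL-++ xs ys f)) (≈-sym (+-assoc _ _ _))

    sumL-map : ∀ {A B : Set} (g : A → B) (xs : List A) (f : B → Carrier) →
               sumL (List.map g xs) f ≈ sumL xs (λ x → f (g x))
    sumL-map g []       f = ≈-refl
    sumL-map g (x ∷ xs) f = +-cong ≈-refl (sumL-map g xs f)

    sumL-const : ∀ {A : Set} (xs : List A) k → sumL xs (λ _ → k) ≈ natCast F (length xs) * k
    sumL-const []       k = ≈-sym (zeroˡ k)
    sumL-const (x ∷ xs) k = ≈-trans (+-cong (≈-sym (*-identityˡ k)) (sumL-const xs k)) (≈-sym (distribʳ k 1# _))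

    _≟ᵥ_ : ∀ {k} (S S' : Subset k) → Dec (S ≡ S')
    _≟ᵥ_ = Vecₚ.≡-dec Bool._≟_

    ind-∷ : ∀ {k} b x (N A : Subset k) → ind ((b ∷ N) ≟ᵥ (x ∷ A)) ≈ ind (b Bool.≟ x) * ind (N ≟ᵥ A)
    ind-∷ b x N A with b Bool.≟ x | N ≟ᵥ A
    ... | yes _ | yes _ = ≈-sym (*-identityˡ 1#)
    ... | yes _ | no _  = ≈-sym (zeroʳ 1#)
    ... | no _  | _     = ≈-sym (zeroˡ _)

    sumL-allSubsets-select : ∀ k (A : Subset k) (h : Subset k → Carrier) →
                             sumL (allSubsets k) (λ N → ind (N ≟ᵥ A) * h N) ≈ h A
    sumL-allSubsets-select zero    [] h = ≈-trans (+-identityʳ _) (*-identityˡ (h []))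
    sumL-allSubsets-select (suc k) (x ∷ A) h = begin
      sumL (List.map (true ∷_) L ++ List.map (false ∷_) L) f
        ≈⟨ sumL-++ (List.map (true ∷_) L) (List.map (false ∷_) L) f ⟩
      sumL (List.map (true ∷_) L) f + sumL (List.map (false ∷_) L) f
        ≈⟨ +-cong (sumL-map (true ∷_) L f) (sumL-map (false ∷_) L f) ⟩
      sumL L (λ N → f (true ∷ N)) + sumL L (λ N → f (false ∷ N))
        ≈⟨ +-cong (select-head true) (select-head false) ⟩
      ind (true Bool.≟ x) * h (true ∷ A) + ind (false Bool.≟ x) * h (false ∷ A)
        ≈⟨ by-head x ⟩
      h (x ∷ A) ∎
      where
      L : List (Subset k)
      L = allSubsets k
      f : Subset (suc k) → Carrier
      f N = ind (N ≟ᵥ (x ∷ A)) * h N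
      select-head : ∀ b → sumL L (λ N → f (b ∷ N)) ≈ ind (b Bool.≟ x) * h (b ∷ A)
      select-head b = begin
        sumL L (λ N → ind ((b ∷ N) ≟ᵥ (x ∷ A)) * h (b ∷ N))
          ≈⟨ sumL-cong L (λ N → ≈-trans (*-cong (ind-∷ b x N A) ≈-refl) (*-assoc _ _ _)) ⟩
        sumL L (λ N → ind (b Bool.≟ x) * (ind (N ≟ᵥ A) * h (b ∷ N)))
          ≈⟨ *-distribˡ-sumL (ind (b Bool.≟ x)) L (λ N → ind (N ≟ᵥ A) * h (b ∷ N)) ⟨
        ind (b Bool.≟ x) * sumL L (λ N → ind (N ≟ᵥ A) * h (b ∷ N))
          ≈⟨ *-cong ≈-refl (sumL-allSubsets-select k A (λ N → h (b ∷ N))) ⟩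
        ind (b Bool.≟ x) * h (b ∷ A) ∎
      by-head : ∀ x → ind (true Bool.≟ x) * h (true ∷ A) + ind (false Bool.≟ x) * h (false ∷ A) ≈ h (x ∷ A)
      by-head true  = ≈-trans (+-cong (*-identityˡ _) (zeroˡ _)) (+-identityʳ _)
      by-head false = ≈-trans (+-cong (zeroˡ _) (*-identityˡ _)) (+-identityˡ _)

  module ProjectionOfΦ {c ℓ} (F : Field c ℓ) (G : Graph) where
    open Field F renaming (refl to ≈-refl; sym to ≈-sym; trans to ≈-trans)
    open Linear F G
    open GraphDefs G using (m; swapN; swapN')
    open ListSums F G
    open import Relation.Binary.Reasoning.Setoid setoid

    L : List (Subset m)
    L = allSubsets m

    δmono : Vec ℕ m → Subset m → Subset m → Carrier
    δmono α N N' = ind (Vecₚ.≡-dec ℕ._≟_ α (mono N N'))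

    swapWeight : List (Subset m) → (M M' N N' : Subset m) → Carrier
    swapWeight cs M M' N N' =
      natCast F (length cs) ⁻¹ * sumL cs (λ C → ind (N ≟S swapN M M' C) * ind (N' ≟S swapN' M M' C))

    sumL-pull : (k : Carrier) (g : Subset m → Subset m → Carrier) →
                sumL L (λ N → sumL L (λ N' → k * g N N')) ≈ k * sumL L (λ N → sumL L (g N))
    sumL-pull k g = ≈-sym (≈-trans (*-distribˡ-sumL k L (λ N → sumL L (g N)))
                               (sumL-cong L (λ N → *-distribˡ-sumL k L (g N))))

    Π-swap : ∀ α M M' C →
             sumL L (λ N → sumL L (λ N' → (ind (N ≟S swapN M M' C) * ind (N' ≟S swapN' M M' C)) * δmono α N N'))
             ≈ δmono α M M'
    Π-swap α M M' C = begin
      sumL L (λ N → sumL L (λ N' → (ind (N ≟S s) * ind (N' ≟S s')) * δmono α N N'))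
        ≈⟨ sumL-cong L (λ N → ≈-trans (sumL-cong L (λ N' → *-assoc _ _ _))
                                    (≈-sym (*-distribˡ-sumL (ind (N ≟S s)) L (λ N' → ind (N' ≟S s') * δmono α N N')))) ⟩
      sumL L (λ N → ind (N ≟S s) * sumL L (λ N' → ind (N' ≟S s') * δmono α N N'))
        ≈⟨ sumL-cong L (λ N → *-cong ≈-refl (sumL-allSubsets-select m s' (δmono α N))) ⟩
      sumL L (λ N → ind (N ≟S s) * δmono α N s')
        ≈⟨ sumL-allSubsets-select m s (λ N → δmono α N s') ⟩
      δmono α s s'
        ≡⟨ cong (λ β → ind (Vecₚ.≡-dec ℕ._≟_ α β)) (mono-swap M M' C) ⟩
      δmono α M M' ∎
      where
      s s' : Subset m
      s  = swapN M M' C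
      s' = swapN' M M' C

    Π-swapWeight : ∀ α M M' cs →
                   sumL L (λ N → sumL L (λ N' → swapWeight cs M M' N N' * δmono α N N'))
                   ≈ natCast F (length cs) ⁻¹ * (natCast F (length cs) * δmono α M M')
    Π-swapWeight α M M' cs = begin
      sumL L (λ N → sumL L (λ N' → (q * sumL cs (I N N')) * δmono α N N'))
        ≈⟨ sumL-cong L (λ N → sumL-cong L (λ N' →
             ≈-trans (*-assoc q _ _) (*-cong ≈-refl (*-distribʳ-sumL (δmono α N N') cs (I N N'))))) ⟩
      sumL L (λ N → sumL L (λ N' → q * sumL cs (λ C → I N N' C * δmono α N N')))
        ≈⟨ sumL-pull q (λ N N' → sumL cs (λ C → I N N' C * δmono α N N')) ⟩
      q * sumL L (λ N → sumL L (λ N' → sumL cs (λ C → I N N' C * δmono α N N')))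
        ≈⟨ *-cong ≈-refl (≈-trans (sumL-cong L (λ N → sumL-comm L cs (λ N' C → I N N' C * δmono α N N')))
                              (sumL-comm L cs (λ N C → sumL L (λ N' → I N N' C * δmono α N N')))) ⟩
      q * sumL cs (λ C → sumL L (λ N → sumL L (λ N' → I N N' C * δmono α N N')))
        ≈⟨ *-cong ≈-refl (sumL-cong cs (Π-swap α M M')) ⟩
      q * sumL cs (λ _ → δmono α M M')
        ≈⟨ *-cong ≈-refl (sumL-const cs (δmono α M M')) ⟩
      q * (natCast F (length cs) * δmono α M M') ∎
      where
      q : Carrier
      q = natCast F (length cs) ⁻¹
      I : Subset m → Subset m → Subset m → Carrier
      I N N' C = ind (N ≟S swapN M M' C) * ind (N' ≟S swapN' M M' C)

    natCast⁻¹-cancel : CharZero F → ∀ k x → natCast F (suc k) ⁻¹ * (natCast F (suc k) * x) ≈ x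
    natCast⁻¹-cancel charZero k x = begin
      n ⁻¹ * (n * x)  ≈⟨ *-assoc _ _ _ ⟨
      (n ⁻¹ * n) * x  ≈⟨ *-cong (*-comm _ _) ≈-refl ⟩
      (n * n ⁻¹) * x  ≈⟨ *-cong (⁻¹-inverse n (λ n≈0 → case charZero (suc k) n≈0 of λ ())) ≈-refl ⟩
      1# * x          ≈⟨ *-identityˡ x ⟩
      x               ∎
      where
      n : Carrier
      n = natCast F (suc k)

    -- Without pink chains the factor (natCast F 0) ⁻¹ is a junk value; x ≈ 0# makes it irrelevant.
    Π-Φ-term : CharZero F → ∀ α M M' cs x → (cs ≡ [] → x ≈ 0#) →
               sumL L (λ N → sumL L (λ N' → (x * swapWeight cs M M' N N') * δmono α N N')) ≈ x * δmono α M M'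
    Π-Φ-term charZero α M M' cs x no-chains⇒x≈0 = begin
      sumL L (λ N → sumL L (λ N' → (x * swapWeight cs M M' N N') * δmono α N N'))
        ≈⟨ sumL-cong L (λ N → sumL-cong L (λ N' → *-assoc _ _ _)) ⟩
      sumL L (λ N → sumL L (λ N' → x * (swapWeight cs M M' N N' * δmono α N N')))
        ≈⟨ sumL-pull x (λ N N' → swapWeight cs M M' N N' * δmono α N N') ⟩
      x * sumL L (λ N → sumL L (λ N' → swapWeight cs M M' N N' * δmono α N N'))
        ≈⟨ *-cong ≈-refl (Π-swapWeight α M M' cs) ⟩
      x * (natCast F (length cs) ⁻¹ * (natCast F (length cs) * δmono α M M'))
        ≈⟨ cancel cs no-chains⇒x≈0 ⟩
      x * δmono α M M' ∎
      where
      cancel : ∀ cs → (cs ≡ [] → x ≈ 0#) →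
               x * (natCast F (length cs) ⁻¹ * (natCast F (length cs) * δmono α M M')) ≈ x * δmono α M M'
      cancel []       x≈0 = ≈-trans (x*≈0 _) (≈-sym (x*≈0 _))
        where
        x*≈0 : ∀ y → x * y ≈ 0#
        x*≈0 y = ≈-trans (*-cong (x≈0 refl) ≈-refl) (zeroˡ y)
      cancel (_ ∷ cs) _   = *-cong ≈-refl (natCast⁻¹-cancel charZero (length cs) (δmono α M M'))

    Π∘Φ≈Π : CharZero F → (chains : Subset m → Subset m → List (Subset m)) → (v : Tensor) →
            (∀ M M' → chains M M' ≡ [] → v M M' ≈ 0#) → ∀ α → Π (Φ chains v) α ≈ Π v α
    Π∘Φ≈Π charZero chains v no-chains⇒v≈0 α = begin
      sumL L (λ N → sumL L (λ N' → Φ chains v N N' * δmono α N N'))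
        ≈⟨ sumL-cong L (λ N → sumL-cong L (λ N' →
             ≈-trans (*-distribʳ-sumL (δmono α N N') L (λ M → sumL L (λ M' → term M M' N N')))
                   (sumL-cong L (λ M → *-distribʳ-sumL (δmono α N N') L (λ M' → term M M' N N'))))) ⟩
      sumL L (λ N → sumL L (λ N' → sumL L (λ M → sumL L (λ M' → term M M' N N' * δmono α N N'))))
        ≈⟨ sumL-comm₂ (λ N N' M M' → term M M' N N' * δmono α N N') ⟩
      sumL L (λ M → sumL L (λ M' → sumL L (λ N → sumL L (λ N' → term M M' N N' * δmono α N N'))))
        ≈⟨ sumL-cong L (λ M → sumL-cong L (λ M' →
             Π-Φ-term charZero α M M' (chains M M') (v M M') (no-chains⇒v≈0 M M'))) ⟩
      sumL L (λ M → sumL L (λ M' → v M M' * δmono α M M')) ∎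
      where
      term : Subset m → Subset m → Subset m → Subset m → Carrier
      term M M' N N' = v M M' * swapWeight (chains M M') M M' N N'
      sumL-comm₂ : (f : Subset m → Subset m → Subset m → Subset m → Carrier) →
                   sumL L (λ a → sumL L (λ b → sumL L (λ c → sumL L (f a b c))))
                   ≈ sumL L (λ c → sumL L (λ d → sumL L (λ a → sumL L (λ b → f a b c d))))
      sumL-comm₂ f = begin
        sumL L (λ a → sumL L (λ b → sumL L (λ c → sumL L (f a b c))))
          ≈⟨ sumL-cong L (λ a → sumL-comm L L (λ b c → sumL L (f a b c))) ⟩
        sumL L (λ a → sumL L (λ c → sumL L (λ b → sumL L (f a b c))))
          ≈⟨ sumL-comm L L (λ a c → sumL L (λ b → sumL L (f a b c))) ⟩
        sumL L (λ c → sumL L (λ a → sumL L (λ b → sumL L (f a b c))))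
          ≈⟨ sumL-cong L (λ c → sumL-cong L (λ a → sumL-comm L L (λ b d → f a b c d))) ⟩
        sumL L (λ c → sumL L (λ a → sumL L (λ d → sumL L (λ b → f a b c d))))
          ≈⟨ sumL-cong L (λ c → sumL-comm L L (λ a d → sumL L (λ b → f a b c d))) ⟩
        sumL L (λ c → sumL L (λ d → sumL L (λ a → sumL L (λ b → f a b c d)))) ∎

-- The bounds 1 ≤ l and k ≤ r only make the spaces nontrivial; the identity holds without them.
theorem2p7 : ∀ {c ℓ' : Level} (F : Field c ℓ') → CharZero F →
    (G : Graph) → (r : ℕ) → GraphDefs.IsMaxMatchingSize G r →
    (l k : ℕ) → 1 ≤ l → l ≤ k → k ≤ r →
    (chains : Subset (Graph.m G) → Subset (Graph.m G) → List (Subset (Graph.m G))) →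
    GraphDefs.IsChainEnumeration G l k chains →
    (v : Linear.Tensor F G) → Linear.InV F G (l ∸ 1) (suc k) v →
    ∀ α → Field._≈_ F (Linear.Π F G (Linear.Φ F G chains v) α) (Linear.Π F G v α)
theorem2p7 F charZero G _ _ l _ _ l≤k _ chains enumeration v v∈V α =
  Polynomials.ProjectionOfΦ.Π∘Φ≈Π F G charZero chains v no-chains⇒v≈0 α
  where
  open Field F using (_≈_; 0#)
  no-chains⇒v≈0 : ∀ M M' → chains M M' ≡ [] → v M M' ≈ 0#
  no-chains⇒v≈0 M M' no-chains = v∈V M M' λ (M∈𝐌 , M'∈𝐌) →
    let (C , pink) = Combinatorics.PinkPaths.pinkChain-exists G M∈𝐌 M'∈𝐌 (≤-trans (m∸n≤m l 1) l≤k)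
        listed     = proj₂ (proj₂ (enumeration M M' M∈𝐌 M'∈𝐌) C) pink
    in case subst (C ∈L_) no-chains listed of λ ()
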